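{- Let $\mathcal{L}$ be a finite meet-semilattice with minimum element $\hat{0}$, let $\mathcal{L}^+=\mathcal{L}\setminus\{\hat 0\}$, and let $\mathbb{B}(\mathcal{L})$ be the family of all building sets of $\mathcal{L}$. Then $(\mathcal{L}^+,\mathbb{B}(\mathcal{L}))$ is a supersolvable convex geometry which is supersolvable with respect to every linear extension of $\mathcal{L}$.
   Context: All posets are finite. For $x\le y$ in a poset, $[x,y]=\{z: x\le z\le y\}$. A poset is irreducible if it is not isomorphic to a product of two posets each having at least two elements (products carry the componentwise order). The set of irreducibles is $I(\mathcal{L})=\{x\in\mathcal{L}^+ : [\hat 0,x]\text{ is irreducible}\}$. For $B\subseteq \mathcal{L}$ and $x\in\mathcal{L}$, $B_{\le x}=\{z\in B: z\le x\}$ and $\max B_{\le x}$ is its set of maximal elements. A subset $B\subseteq\mathcal{L}^+$ is a building set of $\mathcal{L}$ if for every $x\in\mathcal{L}^+$, writing $\max B_{\le x}=\{x_1,\dots,x_k\}$, the map $\phi_x:\prod_{j=1}^k[\hat 0,x_j]\to[\hat 0,x]$, $\phi_x(y_1,\dots,y_k)=y_1\vee\cdots\vee y_k$, is a (well-defined) isomorphism of posets. A linear extension of $\mathcal{L}$ is a total order $<_L$ on $\mathcal{L}$ with $x<y\Rightarrow x<_L y$ (here restricted to $\mathcal{L}^+$). A set system $(\mathcal{E},\mathbb{S})$ with $\mathbb{S}\subseteq 2^{\mathcal{E}}$ is a supersolvable convex geometry with respect to a total order $<$ on $\mathcal{E}$ if (1) $\mathcal{E}\in\mathbb{S}$, and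 (2) for every $A,B\in\mathbb{S}$ with $A\not\subseteq B$, letting $e=\min_<(A\setminus B)$, we have $A\setminus\{e\}\in\mathbb{S}$. -}

module Defs where

open import Level using (0ℓ)
open import Data.Nat using (ℕ)
open import Data.Fin using (Fin)
open import Data.Fin.Subset using (Subset; _∈_; _∉_; _⊆_; _-_; ∁; ⁅_⁆)
open import Data.Product using (Σ; ∃; _×_; _,_)
open import Relation.Binary.PropositionalEquality using (_≡_; _≢_)
open import Relation.Binary.Structures using (IsPartialOrder; IsStrictTotalOrder)
open import Relation.Nullary using (¬_)
open import Function.Bundles using (_⇔_)

-- A finite meet-semilattice with minimum element, on the carrier Fin n
-- (every finite poset is isomorphic to one on Fin n).
record FinMeetSemilattice (n : ℕ) : Set₁ where
  field
    _≤_        : Fin n → Fin n → Set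
    isPartialOrder : IsPartialOrder _≡_ _≤_
    _∧_        : Fin n → Fin n → Fin n
    ∧-lb₁      : ∀ x y → (x ∧ y) ≤ x
    ∧-lb₂      : ∀ x y → (x ∧ y) ≤ y
    ∧-glb      : ∀ x y z → z ≤ x → z ≤ y → z ≤ (x ∧ y)
    𝟘          : Fin n
    𝟘-min      : ∀ x → 𝟘 ≤ x

module _ {n : ℕ} (𝓛 : FinMeetSemilattice n) where
  open FinMeetSemilattice 𝓛

  _<_ : Fin n → Fin n → Set
  x < y = (x ≤ y) × (x ≢ y)

  L⁺ : Subset n
  L⁺ = ∁ ⁅ 𝟘 ⁆

  MaxBelow : Subset n → Fin n → Fin n → Set
  MaxBelow B x i = (i ∈ B) × (i ≤ x) × (∀ j → j ∈ B → j ≤ x → ¬ (i < j))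

  -- elements of ∏_{x_j ∈ max B_{≤x}} [0̂, x_j], encoded as functions on Fin n
  -- which are 0̂ outside max B_{≤x} and satisfy y i ≤ i on it
  Tuple : Subset n → Fin n → Set
  Tuple B x = Σ (Fin n → Fin n) λ y →
                (∀ i → (MaxBelow B x i → y i ≤ i) × (¬ MaxBelow B x i → y i ≡ 𝟘))

  _≤ᵀ_ : ∀ {B x} → Tuple B x → Tuple B x → Set
  _≤ᵀ_ {B} {x} (y , _) (y' , _) = ∀ i → MaxBelow B x i → y i ≤ y' i

  _≡ᵀ_ : ∀ {B x} → Tuple B x → Tuple B x → Set
  (y , _) ≡ᵀ (y' , _) = ∀ i → y i ≡ y' i

  IsJoinOf : ∀ {B x} → Tuple B x → Fin n → Set
  IsJoinOf {B} {x} (y , _) z =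
    (∀ i → MaxBelow B x i → y i ≤ z) ×
    (∀ u → (∀ i → MaxBelow B x i → y i ≤ u) → z ≤ u)

  PhiIso : Subset n → Fin n → Set
  PhiIso B x =
    Σ (Tuple B x → Fin n) λ φ →
      (∀ t → IsJoinOf t (φ t)) ×
      (∀ t → φ t ≤ x) ×
      (∀ t t' → φ t ≡ φ t' → t ≡ᵀ t') ×
      (∀ z → z ≤ x → Σ (Tuple B x) λ t → φ t ≡ z) ×
      (∀ t t' → (t ≤ᵀ t') ⇔ (φ t ≤ φ t'))

  IsBuildingSet : Subset n → Set
  IsBuildingSet B = (B ⊆ L⁺) × (∀ x → x ∈ L⁺ → PhiIso B x)

  IsLinearExtension : (Fin n → Fin n → Set) → Set
  IsLinearExtension _<ₗ_ =
    IsStrictTotalOrder _≡_ _<ₗ_ ×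
    (∀ x y → x ∈ L⁺ → y ∈ L⁺ → x < y → x <ₗ y)

module _ {n : ℕ} where

  IsMinIn : (Fin n → Fin n → Set) → Fin n → Subset n → Set
  IsMinIn _<ₒ_ e S = (e ∈ S) × (∀ e' → e' ∈ S → e' ≢ e → e <ₒ e')

  IsSupersolvableCGWrt : Subset n → (Subset n → Set) → (Fin n → Fin n → Set) → Set
  IsSupersolvableCGWrt E 𝕊 _<ₒ_ =
    (∀ A → 𝕊 A → A ⊆ E) ×
    𝕊 E ×
    (∀ A B → 𝕊 A → 𝕊 B → ¬ (A ⊆ B) →
       ∀ e → IsMinIn _<ₒ_ e (A Data.Fin.Subset.─ B) → 𝕊 (A - e))

  IsSupersolvableCG : Subset n → (Subset n → Set) → Set₁
  IsSupersolvableCG E 𝕊 =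
    Σ (Fin n → Fin n → Set) λ _<ₒ_ →
      IsStrictTotalOrder _≡_ _<ₒ_ × IsSupersolvableCGWrt E 𝕊 _<ₒ_

-- B ⊆ L⁺ is a building set iff for every x ∈ L⁺ the set max B_{≤x} decomposes
-- [0̂,x]: each z ≤ x is the join of the z ∧ i, and the join w of a tuple (y_i)
-- with y_i ≤ i satisfies w ∧ i = y_i.  L⁺ itself is building, as
-- max (L⁺)_{≤x} = {x}.  Now let A, B be building and e the ≤ₗ-least element of
-- A ∖ B.  Since ≤ₗ extends the order, every a ∈ A strictly below e lies in B, so
-- max (A∖e)_{≤e} is the union, over the maximal b ∈ B below e, of the sets
-- max A_{≤b}; composing decompositions (whose components meet in 0̂) shows that
-- A∖e decomposes [0̂,e].  For a general x, max (A∖e)_{≤x} is either max A_{≤x}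
-- or arises from it by replacing e with max (A∖e)_{≤e}.  Ordering the elements
-- by the size of their down-sets gives a linear extension, so a suitable order
-- exists.

module Submission where

open import Defs hiding (_<_)
open import Data.Nat using (ℕ)
open import Data.Fin using (Fin)
open import Data.Product using (_×_)

open import Level using (0ℓ)
import Data.Nat as ℕ
import Data.Nat.Properties as ℕ
import Data.Fin as F
import Data.Fin.Properties as FP
open import Data.Fin.Induction using (po-noetherian)
open import Data.Fin.Subset using (Subset; _∈_; _∉_; _-_; _─_; ⁅_⁆; ∣_∣; inside; outside)
open import Data.Fin.Subset.Properties
  using (_∈?_; x∈⁅x⁆; x∈p∧x≢y⇒x∈p-y; x∈p∧x∉q⇒x∈p─q; p─q⊆p; x∈∁p⇒x∉p; p⊂q⇒∣p∣<∣q∣)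
import Data.Vec.Base as Vec
open import Data.Vec.Properties using (lookup∘tabulate; lookup⇒[]=; []=⇒lookup)
open import Data.List using ([]; _∷_; foldr; filter; allFin)
open import Data.List.Relation.Unary.All as All using (All; []; _∷_)
open import Data.List.Relation.Unary.All.Properties using (all-filter)
open import Data.List.Membership.Propositional.Properties using (∈-allFin; ∈-filter⁺)
open import Data.Product using (Σ; _,_; proj₁; proj₂)
open import Data.Product.Relation.Binary.Lex.Strict using (×-Lex; ×-isStrictTotalOrder)
open import Data.Sum using (_⊎_; inj₁; inj₂)
open import Data.Bool.Properties using (T-≡)
open import Function using (_on_; _∘_; flip; id)
open import Function.Bundles using (_⇔_; mk⇔; Equivalence)
open import Induction.WellFounded using (Acc; acc)
open import Relation.Binary using (Rel; IsPartialOrder; IsStrictTotalOrder)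
open import Relation.Binary.Lattice using (MeetSemilattice)
open import Relation.Binary.Morphism.Structures using (IsOrderMonomorphism)
import Relation.Binary.Morphism.OrderMonomorphism as OrderMonomorphism
open import Relation.Binary.PropositionalEquality
  using (_≡_; _≢_; refl; sym; trans; cong; subst; subst₂; module ≡-Reasoning)
open import Relation.Nullary using (¬_; Dec; isYes; yes; no; contradiction)
open import Relation.Nullary.Decidable
  using (_×-dec_; _→-dec_; _⊎-dec_; ¬?; toWitness; fromWitness; decidable-stable)
open import Relation.Unary using (Pred; Decidable)

x∈p─q⇒x∉q : ∀ {m} {x : Fin m} {p q : Subset m} → x ∈ p ─ q → x ∉ q
x∈p─q⇒x∉q {p = _ Vec.∷ p} {outside Vec.∷ q} Vec.here ()
x∈p─q⇒x∉q {p = _ Vec.∷ p} {inside Vec.∷ q}  ()       Vec.here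
x∈p─q⇒x∉q {p = _ Vec.∷ p} {_ Vec.∷ q} (Vec.there x∈p─q) (Vec.there x∈q) =
  x∈p─q⇒x∉q {p = p} x∈p─q x∈q

x∈p-y⇒x≢y : ∀ {m} {x y : Fin m} {p : Subset m} → x ∈ p - y → x ≢ y
x∈p-y⇒x≢y {y = y} {p} x∈p-y refl = x∈p─q⇒x∉q {p = p} x∈p-y (x∈⁅x⁆ y)

isStrictTotalOrder-on-injection :
  ∀ {a b ℓ₁ ℓ₂} {A : Set a} {B : Set b} {_≈_ : Rel B ℓ₁} {_<_ : Rel B ℓ₂}
  (f : A → B) → (∀ {x y} → f x ≈ f y → x ≡ y) →
  IsStrictTotalOrder _≈_ _<_ → IsStrictTotalOrder _≡_ (_<_ on f)
isStrictTotalOrder-on-injection {_≈_ = _≈_} {_<_} f f-injective sto =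
  OrderMonomorphism.isStrictTotalOrder monomorphism sto
  where
  open IsStrictTotalOrder sto using (module Eq)
  monomorphism : IsOrderMonomorphism _≡_ _≈_ (_<_ on f) _<_ f
  monomorphism = record
    { isOrderHomomorphism = record { cong = λ { refl → Eq.refl } ; mono = id }
    ; injective = f-injective
    ; cancel = id
    }

module FinMeetSemilatticeTheory {n : ℕ} (𝓛 : FinMeetSemilattice n) where
  open FinMeetSemilattice 𝓛
  open IsPartialOrder isPartialOrder using (antisym) renaming (refl to ≤-refl; trans to ≤-trans)
  open import Relation.Binary.Construct.NonStrictToStrict _≡_ _≤_ using (_<_; <⇒≤; <-decidable)

  meetSemilattice : MeetSemilattice 0ℓ 0ℓ 0ℓ
  meetSemilattice = record
    { isMeetSemilattice = record
      { isPartialOrder = isPartialOrder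
      ; infimum = λ x y → ∧-lb₁ x y , ∧-lb₂ x y , ∧-glb x y
      }
    }

  open import Relation.Binary.Lattice.Properties.MeetSemilattice meetSemilattice
    using (∧-comm; ∧-assoc; ∧-monotonic; y≤x⇒x∧y≈y; ≈-dec⇒≤-dec)

  _≤?_ : ∀ x y → Dec (x ≤ y)
  _≤?_ = ≈-dec⇒≤-dec FP._≟_

  _<?_ : ∀ x y → Dec (x < y)
  _<?_ = <-decidable FP._≟_ _≤?_

  x≤y⇒x∧y≡x : ∀ {x y} → x ≤ y → x ∧ y ≡ x
  x≤y⇒x∧y≡x {x} {y} x≤y = trans (∧-comm x y) (y≤x⇒x∧y≈y x≤y)

  ≤𝟘⇒≡𝟘 : ∀ {x} → x ≤ 𝟘 → x ≡ 𝟘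
  ≤𝟘⇒≡𝟘 {x} x≤𝟘 = antisym x≤𝟘 (𝟘-min x)

  Max : Subset n → Fin n → Pred (Fin n) 0ℓ
  Max = MaxBelow 𝓛

  Max? : ∀ B x → Decidable (Max B x)
  Max? B x i = (i ∈? B) ×-dec (i ≤? x) ×-dec
               FP.all? (λ j → (j ∈? B) →-dec ((j ≤? x) →-dec ¬? (i <? j)))

  UpperBound : Pred (Fin n) 0ℓ → (Fin n → Fin n) → Fin n → Set
  UpperBound P f u = ∀ i → P i → f i ≤ u

  IsLub : Pred (Fin n) 0ℓ → (Fin n → Fin n) → Fin n → Set
  IsLub P f z = UpperBound P f z × (∀ u → UpperBound P f u → z ≤ u)

  IsLub-unique : ∀ {P f z z′} → IsLub P f z → IsLub P f z′ → z ≡ z′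
  IsLub-unique (ub , least) (ub′ , least′) = antisym (least _ ub′) (least′ _ ub)

  IsLub-cong-fun : ∀ {P f g z} → (∀ i → P i → f i ≡ g i) → IsLub P f z → IsLub P g z
  IsLub-cong-fun f≗g (ub , least) =
    (λ i p → subst (_≤ _) (f≗g i p) (ub i p)) ,
    (λ u ub′ → least u (λ i p → subst (_≤ u) (sym (f≗g i p)) (ub′ i p)))

  IsLub-cong-pred : ∀ {P Q f z} → (∀ i → P i → Q i) → (∀ i → Q i → P i) →
                    IsLub P f z → IsLub Q f z
  IsLub-cong-pred P⊆Q Q⊆P (ub , least) =
    (λ i q → ub i (Q⊆P i q)) , (λ u ub′ → least u (λ i p → ub′ i (P⊆Q i p)))

  ≤-foldr-∧ : ∀ {v} b us → v ≤ foldr _∧_ b us ⇔ (v ≤ b × All (v ≤_) us)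
  ≤-foldr-∧ b [] = mk⇔ (_, []) proj₁
  ≤-foldr-∧ b (u ∷ us) = mk⇔
    (λ v≤ → let v≤b , v≤us = Equivalence.to (≤-foldr-∧ b us) (≤-trans v≤ (∧-lb₂ u _))
            in v≤b , ≤-trans v≤ (∧-lb₁ u _) ∷ v≤us)
    (λ { (v≤b , v≤u ∷ v≤us) → ∧-glb u _ _ v≤u (Equivalence.from (≤-foldr-∧ b us) (v≤b , v≤us)) })

  -- The meet of b and of all upper bounds of f over P; the join of f over P
  -- whenever b is itself an upper bound.
  ⋁ : (P : Pred (Fin n) 0ℓ) → Decidable P → (Fin n → Fin n) → Fin n → Fin n
  ⋁ P P? f b = foldr _∧_ b (filter (λ u → FP.all? λ i → P? i →-dec (f i ≤? u)) (allFin n))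

  ⋁-lub : ∀ {P f b} (P? : Decidable P) → UpperBound P f b → IsLub P f (⋁ P P? f b)
  ⋁-lub {P} {f} {b} P? f≤b = upper , least
    where
    Bound? = λ u → FP.all? λ i → P? i →-dec (f i ≤? u)
    upper : UpperBound P f (⋁ P P? f b)
    upper i p = Equivalence.from (≤-foldr-∧ b _)
      (f≤b i p , All.map (λ ub → ub i p) (all-filter Bound? (allFin n)))
    least : ∀ u → UpperBound P f u → ⋁ P P? f b ≤ u
    least u ub = All.lookup (proj₂ (Equivalence.to (≤-foldr-∧ b _) ≤-refl))
                            (∈-filter⁺ Bound? (∈-allFin u) ub)

  maximal-above : ∀ (S : Pred (Fin n) 0ℓ) → Decidable S → ∀ {s} → S s →
                  Σ (Fin n) λ m → S m × s ≤ m × (∀ j → S j → ¬ m < j)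
  maximal-above S S? = go (po-noetherian isPartialOrder _)
    where
    go : ∀ {s} → Acc (flip _<_) s → S s → Σ (Fin n) λ m → S m × s ≤ m × (∀ j → S j → ¬ m < j)
    go {s} (acc larger) Ss with FP.any? (λ j → S? j ×-dec (s <? j))
    ... | yes (j , Sj , s<j) =
      let m , Sm , j≤m , m-max = go (larger s<j) Sj in m , Sm , ≤-trans (<⇒≤ s<j) j≤m , m-max
    ... | no nothing-larger = s , Ss , ≤-refl , λ j Sj s<j → nothing-larger (j , Sj , s<j)

  Max-above : ∀ B x {s} → s ∈ B → s ≤ x → Σ (Fin n) λ m → Max B x m × s ≤ m
  Max-above B x s∈B s≤x =
    let m , (m∈B , m≤x) , s≤m , m-max =
          maximal-above (λ j → j ∈ B × j ≤ x) (λ j → (j ∈? B) ×-dec (j ≤? x)) (s∈B , s≤x)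
    in m , (m∈B , m≤x , λ j j∈B j≤x → m-max j (j∈B , j≤x)) , s≤m

  δ : Fin n → Fin n → Fin n
  δ c i with i FP.≟ c
  ... | yes _ = c
  ... | no _ = 𝟘

  δ-≤ : ∀ c i → δ c i ≤ i × δ c i ≤ c
  δ-≤ c i with i FP.≟ c
  ... | yes refl = ≤-refl , ≤-refl
  ... | no _ = 𝟘-min i , 𝟘-min c

  δ-diag : ∀ c → δ c c ≡ c
  δ-diag c with c FP.≟ c
  ... | yes _ = refl
  ... | no c≢c = contradiction refl c≢c

  δ-off : ∀ {c i} → i ≢ c → δ c i ≡ 𝟘
  δ-off {c} {i} i≢c with i FP.≟ c
  ... | yes i≡c = contradiction i≡c i≢c
  ... | no _ = refl

  δ-lub : ∀ {P c} → P c → IsLub P (δ c) c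
  δ-lub {c = c} Pc = (λ i _ → proj₂ (δ-≤ c i)) , λ u ub → subst (_≤ u) (δ-diag c) (ub c Pc)

  InProduct : Pred (Fin n) 0ℓ → (Fin n → Fin n) → Set
  InProduct P y = ∀ i → P i → y i ≤ i

  -- [0̂,x] ≅ ∏_{i ∈ P} [0̂,i] via joins, with meeting by i as the i-th projection.
  record IsDecomposition (P : Pred (Fin n) 0ℓ) (x : Fin n) : Set where
    field
      bounded       : UpperBound P id x
      join-of-meets : ∀ z → z ≤ x → IsLub P (z ∧_) z
      meet-of-join  : ∀ y → InProduct P y → ∀ w → IsLub P y w → ∀ i → P i → w ∧ i ≡ y i

  IsDecomposition-cong : ∀ {P Q x} → (∀ i → P i → Q i) → (∀ i → Q i → P i) →
                         IsDecomposition P x → IsDecomposition Q x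
  IsDecomposition-cong P⊆Q Q⊆P d = record
    { bounded = λ i q → bounded i (Q⊆P i q)
    ; join-of-meets = λ z z≤x → IsLub-cong-pred P⊆Q Q⊆P (join-of-meets z z≤x)
    ; meet-of-join = λ y y∈ w w-lub i q →
        meet-of-join y (λ j p → y∈ j (P⊆Q j p)) w (IsLub-cong-pred Q⊆P P⊆Q w-lub) i (Q⊆P i q)
    }
    where open IsDecomposition d

  singleton-decomposition : ∀ c → IsDecomposition (_≡ c) c
  singleton-decomposition c = record
    { bounded = λ { i refl → ≤-refl }
    ; join-of-meets = λ z z≤c →
        (λ { i refl → ∧-lb₁ z c }) , λ u ub → subst (_≤ u) (x≤y⇒x∧y≡x z≤c) (ub c refl)
    ; meet-of-join = λ { y y∈ w (ub , least) i refl →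
        trans (cong (_∧ c) (antisym (least (y c) λ { j refl → ≤-refl }) (ub c refl)))
              (x≤y⇒x∧y≡x (y∈ c refl)) }
    }

  decomposition-disjoint : ∀ {P x c c′ g} → IsDecomposition P x → P c → P c′ →
                           g ≢ 𝟘 → g ≤ c → g ≤ c′ → c ≡ c′
  decomposition-disjoint {c = c} {c′} {g} d Pc Pc′ g≢𝟘 g≤c g≤c′ with c FP.≟ c′
  ... | yes c≡c′ = c≡c′
  ... | no c≢c′ = contradiction (≤𝟘⇒≡𝟘 (subst (g ≤_) c∧c′≡𝟘 (∧-glb c c′ g g≤c g≤c′))) g≢𝟘
    where
    open IsDecomposition d
    c∧c′≡𝟘 : c ∧ c′ ≡ 𝟘
    c∧c′≡𝟘 = trans (meet-of-join (δ c) (λ i _ → proj₁ (δ-≤ c i)) c (δ-lub Pc) c′ Pc′)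
                   (δ-off (c≢c′ ∘ sym))

  decomposition-refine :
    ∀ {x} (F : Pred (Fin n) 0ℓ) (G : Fin n → Pred (Fin n) 0ℓ) → (∀ c → Decidable (G c)) →
    (H : Pred (Fin n) 0ℓ) → IsDecomposition F x → (∀ c → F c → IsDecomposition (G c) c) →
    (∀ g → H g → Σ (Fin n) λ c → F c × G c g) → (∀ c g → F c → G c g → H g) →
    IsDecomposition H x
  decomposition-refine {x} F G G? H dF dG H⊆⋃G ⋃G⊆H = record
    { bounded = bounded ; join-of-meets = join-of-meets ; meet-of-join = meet-of-join }
    where
    module Coarse = IsDecomposition dF
    module Fine c (Fc : F c) = IsDecomposition (dG c Fc)

    bounded : UpperBound H id x
    bounded g Hg = let c , Fc , Gcg = H⊆⋃G g Hg in
      ≤-trans (Fine.bounded c Fc g Gcg) (Coarse.bounded c Fc)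

    join-of-meets : ∀ z → z ≤ x → IsLub H (z ∧_) z
    join-of-meets z z≤x = (λ g _ → ∧-lb₁ z g) , λ u ub →
      proj₂ (Coarse.join-of-meets z z≤x) u λ c Fc →
        proj₂ (Fine.join-of-meets c Fc (z ∧ c) (∧-lb₂ z c)) u λ g Gcg →
          ≤-trans (∧-monotonic (∧-lb₁ z c) ≤-refl) (ub g (⋃G⊆H c g Fc Gcg))

    meet-of-join : ∀ y → InProduct H y → ∀ w → IsLub H y w → ∀ i → H i → w ∧ i ≡ y i
    meet-of-join y y∈ w w-lub g Hg with H⊆⋃G g Hg
    ... | c , Fc , Gcg = begin
      w ∧ g        ≡⟨ cong (w ∧_) (sym (y≤x⇒x∧y≈y (Fine.bounded c Fc g Gcg))) ⟩
      w ∧ (c ∧ g)  ≡⟨ sym (∧-assoc w c g) ⟩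
      (w ∧ c) ∧ g  ≡⟨ cong (_∧ g) (Coarse.meet-of-join v v∈ w w-lub-v c Fc) ⟩
      v c ∧ g      ≡⟨ Fine.meet-of-join c Fc y (y∈G c Fc) (v c) (v-lub c Fc) g Gcg ⟩
      y g          ∎
      where
      open ≡-Reasoning
      v : Fin n → Fin n
      v c′ = ⋁ (G c′) (G? c′) y c′
      y∈G : ∀ c′ → F c′ → InProduct (G c′) y
      y∈G c′ Fc′ g′ Gg′ = y∈ g′ (⋃G⊆H c′ g′ Fc′ Gg′)
      y≤ : ∀ c′ → F c′ → UpperBound (G c′) y c′
      y≤ c′ Fc′ g′ Gg′ = ≤-trans (y∈G c′ Fc′ g′ Gg′) (Fine.bounded c′ Fc′ g′ Gg′)
      v-lub : ∀ c′ → F c′ → IsLub (G c′) y (v c′)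
      v-lub c′ Fc′ = ⋁-lub (G? c′) (y≤ c′ Fc′)
      v∈ : InProduct F v
      v∈ c′ Fc′ = proj₂ (v-lub c′ Fc′) c′ (y≤ c′ Fc′)
      w-lub-v : IsLub F v w
      w-lub-v =
        (λ c′ Fc′ → proj₂ (v-lub c′ Fc′) w (λ g′ Gg′ → proj₁ w-lub g′ (⋃G⊆H c′ g′ Fc′ Gg′))) ,
        (λ u ub → proj₂ w-lub u λ g′ Hg′ → let c′ , Fc′ , Gg′ = H⊆⋃G g′ Hg′ in
                    ≤-trans (proj₁ (v-lub c′ Fc′) g′ Gg′) (ub c′ Fc′))

  module JoinMap (B : Subset n) (x : Fin n) where
    restrict : (Fin n → Fin n) → Fin n → Fin n
    restrict y i with Max? B x i
    ... | yes _ = y i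
    ... | no _ = 𝟘

    restrict-on : ∀ y {i} → Max B x i → restrict y i ≡ y i
    restrict-on y {i} p with Max? B x i
    ... | yes _ = refl
    ... | no ¬p = contradiction p ¬p

    restrict-off : ∀ y {i} → ¬ Max B x i → restrict y i ≡ 𝟘
    restrict-off y {i} ¬p with Max? B x i
    ... | yes p = contradiction p ¬p
    ... | no _ = refl

    tuple : ∀ y → InProduct (Max B x) y → Tuple 𝓛 B x
    tuple y y∈ = restrict y , λ i →
      (λ p → subst (_≤ i) (sym (restrict-on y p)) (y∈ i p)) , restrict-off y

    restrict-lub : ∀ {y z} → IsLub (Max B x) y z → IsLub (Max B x) (restrict y) z
    restrict-lub {y} = IsLub-cong-fun (λ i p → sym (restrict-on y p))

    tuple-inProduct : (t : Tuple 𝓛 B x) → InProduct (Max B x) (proj₁ t)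
    tuple-inProduct t i = proj₁ (proj₂ t i)

    decomposition⇒PhiIso : IsDecomposition (Max B x) x → PhiIso 𝓛 B x
    decomposition⇒PhiIso d = φ , φ-join , φ-≤ , φ-injective , φ-surjective , φ-order
      where
      open IsDecomposition d
      t≤x : ∀ (t : Tuple 𝓛 B x) → UpperBound (Max B x) (proj₁ t) x
      t≤x t i p = ≤-trans (tuple-inProduct t i p) (bounded i p)
      φ : Tuple 𝓛 B x → Fin n
      φ t = ⋁ (Max B x) (Max? B x) (proj₁ t) x
      φ-join : ∀ t → IsLub (Max B x) (proj₁ t) (φ t)
      φ-join t = ⋁-lub (Max? B x) (t≤x t)
      φ-≤ : ∀ t → φ t ≤ x
      φ-≤ t = proj₂ (φ-join t) x (t≤x t)
      component : ∀ t {i} → Max B x i → φ t ∧ i ≡ proj₁ t i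
      component t {i} p = meet-of-join (proj₁ t) (tuple-inProduct t) (φ t) (φ-join t) i p
      φ-injective : ∀ t t′ → φ t ≡ φ t′ → _≡ᵀ_ 𝓛 t t′
      φ-injective t t′ φt≡φt′ i with Max? B x i
      ... | yes p = trans (sym (component t p)) (trans (cong (_∧ i) φt≡φt′) (component t′ p))
      ... | no ¬p = trans (proj₂ (proj₂ t i) ¬p) (sym (proj₂ (proj₂ t′ i) ¬p))
      φ-surjective : ∀ z → z ≤ x → Σ (Tuple 𝓛 B x) λ t → φ t ≡ z
      φ-surjective z z≤x = t , IsLub-unique (φ-join t) (restrict-lub (join-of-meets z z≤x))
        where t = tuple (z ∧_) (λ i _ → ∧-lb₂ z i)
      φ-order : ∀ t t′ → _≤ᵀ_ 𝓛 t t′ ⇔ (φ t ≤ φ t′)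
      φ-order t t′ = mk⇔
        (λ t≤t′ → proj₂ (φ-join t) (φ t′) λ i p → ≤-trans (t≤t′ i p) (proj₁ (φ-join t′) i p))
        (λ φt≤φt′ i p → subst₂ _≤_ (component t p) (component t′ p) (∧-monotonic φt≤φt′ ≤-refl))

    PhiIso⇒decomposition : PhiIso 𝓛 B x → IsDecomposition (Max B x) x
    PhiIso⇒decomposition (φ , φ-join , φ-≤ , _ , φ-surjective , φ-order) = record
      { bounded = λ i p → proj₁ (proj₂ p)
      ; join-of-meets = join-of-meets
      ; meet-of-join = meet-of-join
      }
      where
      -- w ∧ i is the image of a tuple s below both t = (y_j) and δ i, so s vanishes
      -- off the index i and s_i ≤ y_i.
      meet-of-join : ∀ y → InProduct (Max B x) y → ∀ w → IsLub (Max B x) y w →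
                     ∀ i → Max B x i → w ∧ i ≡ y i
      meet-of-join y y∈ w w-lub i p with φ-surjective (w ∧ i) (≤-trans (∧-lb₁ w i) w≤x)
        where
        w≤x : w ≤ x
        w≤x = proj₂ w-lub x λ j q → ≤-trans (y∈ j q) (proj₁ (proj₂ q))
      ... | s , φs≡w∧i = antisym (subst (_≤ y i) φs≡w∧i (proj₂ (φ-join s) (y i) s≤yi))
                                 (∧-glb w i (y i) (proj₁ w-lub i p) (y∈ i p))
        where
        t = tuple y y∈
        d = tuple (δ i) (λ j _ → proj₁ (δ-≤ i j))
        s≤t : _≤ᵀ_ 𝓛 s t
        s≤t = Equivalence.from (φ-order s t)
          (subst₂ _≤_ (sym φs≡w∧i) (IsLub-unique (restrict-lub w-lub) (φ-join t)) (∧-lb₁ w i))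
        s≤d : _≤ᵀ_ 𝓛 s d
        s≤d = Equivalence.from (φ-order s d)
          (subst₂ _≤_ (sym φs≡w∧i) (IsLub-unique (restrict-lub (δ-lub p)) (φ-join d)) (∧-lb₂ w i))
        s≤yi : UpperBound (Max B x) (proj₁ s) (y i)
        s≤yi j q with j FP.≟ i
        ... | yes refl = subst (proj₁ s j ≤_) (restrict-on y q) (s≤t j q)
        ... | no j≢i = subst (_≤ y i) (sym (≤𝟘⇒≡𝟘 s_j≤𝟘)) (𝟘-min (y i))
          where
          s_j≤𝟘 : proj₁ s j ≤ 𝟘
          s_j≤𝟘 = subst (proj₁ s j ≤_) (trans (restrict-on (δ i) q) (δ-off j≢i)) (s≤d j q)

      join-of-meets : ∀ z → z ≤ x → IsLub (Max B x) (z ∧_) z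
      join-of-meets z z≤x =
        let s , φs≡z = φ-surjective z z≤x
            s-lub = φ-join s
        in subst (λ z → IsLub (Max B x) (z ∧_) z) φs≡z
             (IsLub-cong-fun
               (λ j q → sym (meet-of-join (proj₁ s) (tuple-inProduct s) (φ s) s-lub j q)) s-lub)

  open JoinMap using (decomposition⇒PhiIso; PhiIso⇒decomposition)

  L⁺-isBuildingSet : IsBuildingSet 𝓛 (L⁺ 𝓛)
  L⁺-isBuildingSet = id , λ x x∈L⁺ → decomposition⇒PhiIso (L⁺ 𝓛) x
    (IsDecomposition-cong
      (λ { i refl → x∈L⁺ , ≤-refl , λ j _ j≤x (x≤j , x≢j) → x≢j (antisym x≤j j≤x) })
      (λ { i (_ , i≤x , i-max) →
             decidable-stable (i FP.≟ x) λ i≢x → i-max x x∈L⁺ ≤-refl (i≤x , i≢x) })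
      (singleton-decomposition x))

  module RemoveMinimal (_<ₗ_ : Fin n → Fin n → Set) (extension : IsLinearExtension 𝓛 _<ₗ_)
                       {A B : Subset n} (A-building : IsBuildingSet 𝓛 A)
                       (B-building : IsBuildingSet 𝓛 B)
                       {e : Fin n} (e-min : IsMinIn _<ₗ_ e (A ─ B)) where
    open IsStrictTotalOrder (proj₁ extension) using ()
      renaming (irrefl to <ₗ-irrefl; trans to <ₗ-trans)

    A′ : Subset n
    A′ = A - e

    e∈A : e ∈ A
    e∈A = p─q⊆p A B (proj₁ e-min)

    e∉B : e ∉ B
    e∉B = x∈p─q⇒x∉q {p = A} (proj₁ e-min)

    e∈L⁺ : e ∈ L⁺ 𝓛
    e∈L⁺ = proj₁ A-building e∈A

    A-nonzero : ∀ {a} → a ∈ A → a ≢ 𝟘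
    A-nonzero a∈A refl = x∈∁p⇒x∉p (proj₁ A-building a∈A) (x∈⁅x⁆ 𝟘)

    A′⊆A : ∀ {i} → i ∈ A′ → i ∈ A
    A′⊆A = p─q⊆p A ⁅ e ⁆

    A′-≢e : ∀ {i} → i ∈ A′ → i ≢ e
    A′-≢e = x∈p-y⇒x≢y {p = A}

    A⇒A′ : ∀ {i} → i ∈ A → i ≢ e → i ∈ A′
    A⇒A′ = x∈p∧x≢y⇒x∈p-y

    below-e⇒∈B : ∀ {a} → a ∈ A → a < e → a ∈ B
    below-e⇒∈B {a} a∈A a<e = decidable-stable (a ∈? B) λ a∉B →
      <ₗ-irrefl refl (<ₗ-trans (proj₂ e-min a (x∈p∧x∉q⇒x∈p─q a∈A a∉B) (proj₂ a<e))
                               (proj₂ extension a e (proj₁ A-building a∈A) e∈L⁺ a<e))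

    ≤B-below-e⇒≢e : ∀ {j b} → b ∈ B → j ≤ b → b ≤ e → j ≢ e
    ≤B-below-e⇒≢e b∈B j≤b b≤e refl = e∉B (subst (_∈ B) (antisym b≤e j≤b) b∈B)

    A-decomposes : ∀ {y} → y ∈ L⁺ 𝓛 → IsDecomposition (Max A y) y
    A-decomposes {y} y∈L⁺ = PhiIso⇒decomposition A y (proj₂ A-building y y∈L⁺)

    B-decomposes : ∀ {y} → y ∈ L⁺ 𝓛 → IsDecomposition (Max B y) y
    B-decomposes {y} y∈L⁺ = PhiIso⇒decomposition B y (proj₂ B-building y y∈L⁺)

    A′-decomposes-e : IsDecomposition (Max A′ e) e
    A′-decomposes-e = decomposition-refine (Max B e) (Max A) (Max? A) (Max A′ e)
      (B-decomposes e∈L⁺) (λ b b-max → A-decomposes (proj₁ B-building (proj₁ b-max))) split merge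
      where
      split : ∀ g → Max A′ e g → Σ (Fin n) λ b → Max B e b × Max A b g
      split g (g∈A′ , g≤e , g-max) =
        let g∈B = below-e⇒∈B (A′⊆A g∈A′) (g≤e , A′-≢e g∈A′)
            b , b-max@(b∈B , b≤e , _) , g≤b = Max-above B e g∈B g≤e
        in b , b-max , A′⊆A g∈A′ , g≤b , λ j j∈A j≤b g<j →
             g-max j (A⇒A′ j∈A (≤B-below-e⇒≢e b∈B j≤b b≤e)) (≤-trans j≤b b≤e) g<j
      merge : ∀ b g → Max B e b → Max A b g → Max A′ e g
      merge b g b-max@(b∈B , b≤e , _) (g∈A , g≤b , g-max) =
        A⇒A′ g∈A (≤B-below-e⇒≢e b∈B g≤b b≤e) , ≤-trans g≤b b≤e , λ j j∈A′ j≤e g<j →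
          let j≤e′ = j≤e , A′-≢e j∈A′
              b′ , b′-max , j≤b′ = Max-above B e (below-e⇒∈B (A′⊆A j∈A′) j≤e′) j≤e
              b≡b′ = decomposition-disjoint (B-decomposes e∈L⁺) b-max b′-max (A-nonzero g∈A)
                                            g≤b (≤-trans (<⇒≤ g<j) j≤b′)
          in g-max j (A′⊆A j∈A′) (subst (j ≤_) (sym b≡b′) j≤b′) g<j

    Replace : Fin n → Pred (Fin n) 0ℓ
    Replace c g = (c ≡ e × Max A′ e g) ⊎ (c ≢ e × g ≡ c)

    Replace-decomposes : ∀ c → IsDecomposition (Replace c) c
    Replace-decomposes c with c FP.≟ e
    ... | yes refl = IsDecomposition-cong (λ _ → inj₁ ∘ (refl ,_))
      (λ { _ (inj₁ (_ , g-max)) → g-max ; _ (inj₂ (e≢e , _)) → contradiction refl e≢e })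
      A′-decomposes-e
    ... | no c≢e = IsDecomposition-cong (λ _ → inj₂ ∘ (c≢e ,_))
      (λ { _ (inj₁ (c≡e , _)) → contradiction c≡e c≢e ; _ (inj₂ (_ , g≡c)) → g≡c })
      (singleton-decomposition c)

    A′-decomposes-if-e-max : ∀ {x} → x ∈ L⁺ 𝓛 → Max A x e → IsDecomposition (Max A′ x) x
    A′-decomposes-if-e-max {x} x∈L⁺ e-max@(_ , e≤x , _) =
      decomposition-refine (Max A x) Replace Replace? (Max A′ x) (A-decomposes x∈L⁺)
        (λ c _ → Replace-decomposes c) split merge
      where
      Replace? : ∀ c → Decidable (Replace c)
      Replace? c g = ((c FP.≟ e) ×-dec Max? A′ e g) ⊎-dec (¬? (c FP.≟ e) ×-dec (g FP.≟ c))
      split : ∀ g → Max A′ x g → Σ (Fin n) λ c → Max A x c × Replace c g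
      split g (g∈A′ , g≤x , g-max) with Max-above A x (A′⊆A g∈A′) g≤x
      ... | c , c-max@(c∈A , c≤x , _) , g≤c with c FP.≟ e
      ...   | yes refl =
        c , c-max , inj₁ (refl , g∈A′ , g≤c , λ j j∈A′ j≤e → g-max j j∈A′ (≤-trans j≤e e≤x))
      ...   | no c≢e = c , c-max , inj₂ (c≢e , decidable-stable (g FP.≟ c) λ g≢c →
                                             g-max c (A⇒A′ c∈A c≢e) c≤x (g≤c , g≢c))
      merge : ∀ c g → Max A x c → Replace c g → Max A′ x g
      merge c g (c∈A , c≤x , c-max) (inj₂ (c≢e , refl)) =
        A⇒A′ c∈A c≢e , c≤x , λ j j∈A′ → c-max j (A′⊆A j∈A′)
      merge c g (c∈A , c≤x , c-max) (inj₁ (refl , g∈A′ , g≤e , g-max)) =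
        g∈A′ , ≤-trans g≤e c≤x , λ j j∈A′ j≤x g<j →
          let m , m-max , j≤m = Max-above A x (A′⊆A j∈A′) j≤x
              e≡m = decomposition-disjoint (A-decomposes x∈L⁺) e-max m-max (A-nonzero (A′⊆A g∈A′))
                                           g≤e (≤-trans (<⇒≤ g<j) j≤m)
          in g-max j j∈A′ (subst (j ≤_) (sym e≡m) j≤m) g<j

    Max-A′⇒Max-A : ∀ {x i} → ¬ Max A x e → Max A′ x i → Max A x i
    Max-A′⇒Max-A {x} {i} ¬e-max (i∈A′ , i≤x , i-max) = A′⊆A i∈A′ , i≤x , i-max-A
      where
      i-max-A : ∀ j → j ∈ A → j ≤ x → ¬ i < j
      i-max-A j j∈A j≤x i<j with j FP.≟ e
      ... | no j≢e = i-max j (A⇒A′ j∈A j≢e) j≤x i<j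
      ... | yes refl =
        let m , m-max@(m∈A , m≤x , _) , e≤m = Max-above A x e∈A j≤x
            m≢e : m ≢ e
            m≢e m≡e = ¬e-max (subst (Max A x) m≡e m-max)
            i≢m : i ≢ m
            i≢m i≡m = proj₂ i<j (antisym (proj₁ i<j) (subst (e ≤_) (sym i≡m) e≤m))
        in i-max m (A⇒A′ m∈A m≢e) m≤x (≤-trans (proj₁ i<j) e≤m , i≢m)

    Max-A⇒Max-A′ : ∀ {x i} → ¬ Max A x e → Max A x i → Max A′ x i
    Max-A⇒Max-A′ ¬e-max i-max@(i∈A , i≤x , i-maxA) =
      A⇒A′ i∈A (λ { refl → ¬e-max i-max }) , i≤x , λ j j∈A′ → i-maxA j (A′⊆A j∈A′)

    A′-decomposes : ∀ {x} → x ∈ L⁺ 𝓛 → IsDecomposition (Max A′ x) x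
    A′-decomposes {x} x∈L⁺ with Max? A x e
    ... | yes e-max = A′-decomposes-if-e-max x∈L⁺ e-max
    ... | no ¬e-max = IsDecomposition-cong (λ _ → Max-A⇒Max-A′ ¬e-max)
                                           (λ _ → Max-A′⇒Max-A ¬e-max)
                                           (A-decomposes x∈L⁺)

    A′-isBuildingSet : IsBuildingSet 𝓛 A′
    A′-isBuildingSet =
      proj₁ A-building ∘ A′⊆A , λ x x∈L⁺ → decomposition⇒PhiIso A′ x (A′-decomposes x∈L⁺)

  building-sets-supersolvable : ∀ _<ₗ_ → IsLinearExtension 𝓛 _<ₗ_ →
                                IsSupersolvableCGWrt (L⁺ 𝓛) (IsBuildingSet 𝓛) _<ₗ_
  building-sets-supersolvable _<ₗ_ extension =
    (λ _ → proj₁) , L⁺-isBuildingSet , λ _ _ A-building B-building _ _ e-min →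
      RemoveMinimal.A′-isBuildingSet _<ₗ_ extension A-building B-building e-min

  downset : Fin n → Subset n
  downset x = Vec.tabulate (λ z → isYes (z ≤? x))

  ∈-downset⁺ : ∀ {x z} → z ≤ x → z ∈ downset x
  ∈-downset⁺ {x} {z} z≤x = lookup⇒[]= z (downset x)
    (trans (lookup∘tabulate _ z) (Equivalence.to T-≡ (fromWitness {a? = z ≤? x} z≤x)))

  ∈-downset⁻ : ∀ {x z} → z ∈ downset x → z ≤ x
  ∈-downset⁻ {x} {z} z∈ = toWitness {a? = z ≤? x}
    (Equivalence.from T-≡ (trans (sym (lookup∘tabulate _ z)) ([]=⇒lookup z∈)))

  rank : Fin n → ℕ
  rank x = ∣ downset x ∣

  rank-strictMono : ∀ {x y} → x < y → rank x ℕ.< rank y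
  rank-strictMono {x} {y} (x≤y , x≢y) = p⊂q⇒∣p∣<∣q∣
    ( (λ z∈ → ∈-downset⁺ (≤-trans (∈-downset⁻ z∈) x≤y))
    , y , ∈-downset⁺ ≤-refl , λ y∈ → x≢y (antisym x≤y (∈-downset⁻ y∈)) )

  _<ₗ_ : Fin n → Fin n → Set
  _<ₗ_ = ×-Lex _≡_ ℕ._<_ F._<_ on (λ x → rank x , x)

  <ₗ-isStrictTotalOrder : IsStrictTotalOrder _≡_ _<ₗ_
  <ₗ-isStrictTotalOrder = isStrictTotalOrder-on-injection (λ x → rank x , x) proj₂
    (×-isStrictTotalOrder ℕ.<-isStrictTotalOrder FP.<-isStrictTotalOrder)

  <ₗ-isLinearExtension : IsLinearExtension 𝓛 _<ₗ_
  <ₗ-isLinearExtension = <ₗ-isStrictTotalOrder , λ _ _ _ _ x<y → inj₁ (rank-strictMono x<y)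

proposition3p14 : ∀ {n : ℕ} (𝓛 : FinMeetSemilattice n) →
    IsSupersolvableCG (L⁺ 𝓛) (IsBuildingSet 𝓛) ×
    (∀ (_<ₗ_ : Fin n → Fin n → Set) → IsLinearExtension 𝓛 _<ₗ_ →
      IsSupersolvableCGWrt (L⁺ 𝓛) (IsBuildingSet 𝓛) _<ₗ_)
proposition3p14 𝓛 =
  (_<ₗ_ , <ₗ-isStrictTotalOrder , building-sets-supersolvable _<ₗ_ <ₗ-isLinearExtension) ,
  building-sets-supersolvable
  where open FinMeetSemilatticeTheory 𝓛
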